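{- Let $w$ be an infinite word over a three-letter alphabet such that $\rho_w(n) \leq 3$ for every positive integer $n$ and $w$ admits letter frequencies which are rationally independent. Then $\rho_w(n) = 3$ for every positive integer $n$.
   Context: For an infinite word $w$, letter frequencies are $f_w(i) = \lim_n |\mathrm{pref}_n(w)|_i/n$, where $|u|_i$ counts occurrences of letter $i$ in $u$ and $\mathrm{pref}_n(w)$ is the length-$n$ prefix; rationally independent means linearly independent over $\mathbb{Q}$. Two finite words are abelian equivalent if they have the same number of occurrences of each letter. The abelian complexity $\rho_w(n)$ ($n\ge1$) is the number of abelian equivalence classes of length-$n$ factors of $w$. -}

module Defs where

open import Data.Nat using (ℕ; zero; suc; _+_; _≤_)
open import Data.Fin using (Fin; zero; suc; _≟_)
open import Data.Integer using (+_)
open import Data.Rational using (ℚ; _/_; _<_; ∣_∣; _-_; _*_; 0ℚ)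
import Data.Rational as Q
open import Data.Bool using (if_then_else_)
open import Data.Product using (Σ; ∃; _×_)
open import Relation.Nullary using (¬_)
open import Relation.Nullary.Decidable using (⌊_⌋)
open import Relation.Binary.PropositionalEquality using (_≡_; _≢_)

Word : Set
Word = ℕ → Fin 3

countFrom : Word → Fin 3 → ℕ → ℕ → ℕ
countFrom w a i zero    = 0
countFrom w a i (suc n) = (if ⌊ w i ≟ a ⌋ then 1 else 0) + countFrom w a (suc i) n

AbEq : Word → ℕ → ℕ → ℕ → Set
AbEq w n i j = ∀ a → countFrom w a i n ≡ countFrom w a j n

-- ρ_w(n) ≤ k : k factor-representatives cover all abelian classes of length-n factors.
AbComplexity≤ : Word → ℕ → ℕ → Set
AbComplexity≤ w n k = Σ (Fin k → ℕ) λ p → ∀ i → ∃ λ t → AbEq w n i (p t)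

-- ρ_w(n) ≥ k : there are k pairwise non-abelian-equivalent length-n factors.
AbComplexity≥ : Word → ℕ → ℕ → Set
AbComplexity≥ w n k = Σ (Fin k → ℕ) λ p → ∀ s t → s ≢ t → ¬ AbEq w n (p s) (p t)

AbComplexity≡ : Word → ℕ → ℕ → Set
AbComplexity≡ w n k = AbComplexity≤ w n k × AbComplexity≥ w n k

freqSeq : Word → Fin 3 → ℕ → ℚ
freqSeq w a n = (+ countFrom w a 0 (suc n)) / suc n

eps : ℕ → ℚ
eps k = (+ 1) / suc k

-- A rational sequence converges to a real number (Cauchy criterion).
Converges : (ℕ → ℚ) → Set
Converges x = ∀ k → ∃ λ N → ∀ m n → N ≤ m → N ≤ n → ∣ x m - x n ∣ < eps k

TendsToZero : (ℕ → ℚ) → Set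
TendsToZero x = ∀ k → ∃ λ N → ∀ n → N ≤ n → ∣ x n ∣ < eps k

HasFrequencies : Word → Set
HasFrequencies w = ∀ a → Converges (freqSeq w a)

-- The frequencies are linearly independent over ℚ: for every nonzero rational
-- vector q, the limit Σ_a q_a f_w(a) = lim_n Σ_a q_a freqSeq w a n is not 0.
RationallyIndependentFreqs : Word → Set
RationallyIndependentFreqs w =
  (q : Fin 3 → ℚ) → (∃ λ a → q a ≢ 0ℚ) →
  ¬ TendsToZero (λ n → (q zero * freqSeq w zero n Q.+ q (suc zero) * freqSeq w (suc zero) n)
                       Q.+ q (suc (suc zero)) * freqSeq w (suc (suc zero)) n)

{-# OPTIONS --safe #-}
module Submission where

-- If some length n ≥ 1 had at most two abelian classes, with Parikh vectors P and Q, then,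
-- as both have coordinate sum n, some nonzero integer vector z is orthogonal to both: the
-- cross product P ⨯ Q, or, when it vanishes (and then P₀ = Q₀), n e₀ − P₀ (1, 1, 1).
-- Every length-n factor then has z-weight 0, so cutting a prefix into blocks of length n
-- bounds its z-weight by ‖z‖₁ n, and Σₐ zₐ fₐ = lim (weight / length) = 0, contradicting
-- independence. A cover by three representatives two of which are equivalent shrinks to a
-- cover by two, so the three representatives are pairwise inequivalent.

open import Defs
open import Data.Nat as ℕ using (ℕ; zero; suc; _+_; _*_; _≤_; NonZero)
import Data.Nat.Properties as ℕ
open import Data.Nat.DivMod using (_%_; _/_; m≡m%n+[m/n]*n; m%n<n)
open import Data.Bool using (true; false; if_then_else_)
open import Data.Fin using (Fin; punchIn; punchOut; _≟_)
open import Data.Fin.Patterns using (0F; 1F; 2F)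
open import Data.Fin.Properties using (punchIn-punchOut; all?; ¬∀⟶∃¬)
open import Data.Integer as ℤ using (ℤ; +_; 0ℤ)
import Data.Integer.Properties as ℤ
open import Data.Integer.Tactic.RingSolver using (solve-∀)
import Data.Rational as ℚ
import Data.Rational.Properties as ℚ
open import Data.Rational.Unnormalised as ℚᵘ using (ℚᵘ; mkℚᵘ; *≡*; *<*)
import Data.Rational.Unnormalised.Properties as ℚᵘ
open import Data.Product using (∃; _×_; _,_; proj₁)
open import Function using (_∘_)
open import Relation.Nullary using (¬_; yes; no)
open import Relation.Nullary.Decidable using (⌊_⌋)
open import Relation.Binary.PropositionalEquality

countFrom-+ : ∀ w a i m m′ → countFrom w a i (m + m′) ≡ countFrom w a i m + countFrom w a (i + m) m′
countFrom-+ w a i zero    m′ = cong (λ j → countFrom w a j m′) (sym (ℕ.+-identityʳ i))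
countFrom-+ w a i (suc m) m′ = begin
  δ + countFrom w a (suc i) (m + m′)                           ≡⟨ cong (_+_ δ) (countFrom-+ w a (suc i) m m′) ⟩
  δ + (countFrom w a (suc i) m + countFrom w a (suc i + m) m′) ≡⟨ sym (ℕ.+-assoc δ _ _) ⟩
  countFrom w a i (suc m) + countFrom w a (suc i + m) m′       ≡⟨ cong (λ j → countFrom w a i (suc m) + countFrom w a j m′) (sym (ℕ.+-suc i m)) ⟩
  countFrom w a i (suc m) + countFrom w a (i + suc m) m′       ∎
  where
  open ≡-Reasoning
  δ : ℕ
  δ = if ⌊ w i ≟ a ⌋ then 1 else 0

countFrom≤ : ∀ w a i m → countFrom w a i m ≤ m
countFrom≤ w a i zero = ℕ.z≤n
countFrom≤ w a i (suc m) with ⌊ w i ≟ a ⌋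
... | true  = ℕ.s≤s (countFrom≤ w a (suc i) m)
... | false = ℕ.m≤n⇒m≤1+n (countFrom≤ w a (suc i) m)

countFrom-total : ∀ w i m → (countFrom w 0F i m + countFrom w 1F i m) + countFrom w 2F i m ≡ m
countFrom-total w i zero = refl
countFrom-total w i (suc m) with w i | countFrom-total w (suc i) m
... | 0F | ih = cong suc ih
... | 1F | ih = trans (cong (_+ countFrom w 2F (suc i) m) (ℕ.+-suc (countFrom w 0F (suc i) m) _)) (cong suc ih)
... | 2F | ih = trans (ℕ.+-suc (countFrom w 0F (suc i) m + countFrom w 1F (suc i) m) _) (cong suc ih)

ℤ³ : Set
ℤ³ = Fin 3 → ℤ

_∙_ : ℤ³ → ℤ³ → ℤ
u ∙ v = (u 0F ℤ.* v 0F ℤ.+ u 1F ℤ.* v 1F) ℤ.+ u 2F ℤ.* v 2F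

sum₃ : ℤ³ → ℤ
sum₃ v = (v 0F ℤ.+ v 1F) ℤ.+ v 2F

‖_‖₁ : ℤ³ → ℕ
‖ v ‖₁ = (ℤ.∣ v 0F ∣ + ℤ.∣ v 1F ∣) + ℤ.∣ v 2F ∣

∙-congˡ : ∀ z {u v} → (∀ a → u a ≡ v a) → z ∙ u ≡ z ∙ v
∙-congˡ z u≗v rewrite u≗v 0F | u≗v 1F | u≗v 2F = refl

∙-distribˡ-+ : ∀ z u v → z ∙ (λ a → u a ℤ.+ v a) ≡ z ∙ u ℤ.+ z ∙ v
∙-distribˡ-+ z u v = identity (z 0F) (z 1F) (z 2F) (u 0F) (u 1F) (u 2F) (v 0F) (v 1F) (v 2F)
  where
  identity : ∀ a b c d e f g h i →
             (a ℤ.* (d ℤ.+ g) ℤ.+ b ℤ.* (e ℤ.+ h)) ℤ.+ c ℤ.* (f ℤ.+ i)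
             ≡ ((a ℤ.* d ℤ.+ b ℤ.* e) ℤ.+ c ℤ.* f) ℤ.+ ((a ℤ.* g ℤ.+ b ℤ.* h) ℤ.+ c ℤ.* i)
  identity = solve-∀

∙-zeroʳ : ∀ z → z ∙ (λ _ → 0ℤ) ≡ 0ℤ
∙-zeroʳ z rewrite ℤ.*-zeroʳ (z 0F) | ℤ.*-zeroʳ (z 1F) | ℤ.*-zeroʳ (z 2F) = refl

∣∙∣≤ : ∀ z {v B} → (∀ a → ℤ.∣ v a ∣ ≤ B) → ℤ.∣ z ∙ v ∣ ≤ ‖ z ‖₁ * B
∣∙∣≤ z {v} {B} ∣v∣≤B = begin
  ℤ.∣ z ∙ v ∣                                                  ≤⟨ ℤ.∣i+j∣≤∣i∣+∣j∣ (term 0F ℤ.+ term 1F) (term 2F) ⟩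
  ℤ.∣ term 0F ℤ.+ term 1F ∣ + ℤ.∣ term 2F ∣                  ≤⟨ ℕ.+-monoˡ-≤ _ (ℤ.∣i+j∣≤∣i∣+∣j∣ (term 0F) (term 1F)) ⟩
  (ℤ.∣ term 0F ∣ + ℤ.∣ term 1F ∣) + ℤ.∣ term 2F ∣             ≤⟨ ℕ.+-mono-≤ (ℕ.+-mono-≤ (bound 0F) (bound 1F)) (bound 2F) ⟩
  (ℤ.∣ z 0F ∣ * B + ℤ.∣ z 1F ∣ * B) + ℤ.∣ z 2F ∣ * B          ≡⟨ sym (cong (_+ ℤ.∣ z 2F ∣ * B) (ℕ.*-distribʳ-+ B (ℤ.∣ z 0F ∣) (ℤ.∣ z 1F ∣))) ⟩
  (ℤ.∣ z 0F ∣ + ℤ.∣ z 1F ∣) * B + ℤ.∣ z 2F ∣ * B              ≡⟨ sym (ℕ.*-distribʳ-+ B (ℤ.∣ z 0F ∣ + ℤ.∣ z 1F ∣) (ℤ.∣ z 2F ∣)) ⟩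
  ‖ z ‖₁ * B                                                   ∎
  where
  open ℕ.≤-Reasoning
  term : Fin 3 → ℤ
  term a = z a ℤ.* v a
  bound : ∀ a → ℤ.∣ term a ∣ ≤ ℤ.∣ z a ∣ * B
  bound a rewrite ℤ.∣i*j∣≡∣i∣*∣j∣ (z a) (v a) = ℕ.*-monoʳ-≤ ℤ.∣ z a ∣ (∣v∣≤B a)

_⨯_ : ℤ³ → ℤ³ → ℤ³
(u ⨯ v) 0F = u 1F ℤ.* v 2F ℤ.- u 2F ℤ.* v 1F
(u ⨯ v) 1F = u 2F ℤ.* v 0F ℤ.- u 0F ℤ.* v 2F
(u ⨯ v) 2F = u 0F ℤ.* v 1F ℤ.- u 1F ℤ.* v 0F

⨯-orthogonalˡ : ∀ u v → (u ⨯ v) ∙ u ≡ 0ℤ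
⨯-orthogonalˡ u v = identity (u 0F) (u 1F) (u 2F) (v 0F) (v 1F) (v 2F)
  where
  identity : ∀ a b c d e f →
    ((b ℤ.* f ℤ.- c ℤ.* e) ℤ.* a ℤ.+ (c ℤ.* d ℤ.- a ℤ.* f) ℤ.* b) ℤ.+ (a ℤ.* e ℤ.- b ℤ.* d) ℤ.* c ≡ 0ℤ
  identity = solve-∀

⨯-orthogonalʳ : ∀ u v → (u ⨯ v) ∙ v ≡ 0ℤ
⨯-orthogonalʳ u v = identity (u 0F) (u 1F) (u 2F) (v 0F) (v 1F) (v 2F)
  where
  identity : ∀ a b c d e f →
    ((b ℤ.* f ℤ.- c ℤ.* e) ℤ.* d ℤ.+ (c ℤ.* d ℤ.- a ℤ.* f) ℤ.* e) ℤ.+ (a ℤ.* e ℤ.- b ℤ.* d) ℤ.* f ≡ 0ℤ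
  identity = solve-∀

sum₃-*-⨯ : ∀ u v → sum₃ v ℤ.* u 0F ≡ sum₃ u ℤ.* v 0F ℤ.+ ((u ⨯ v) 2F ℤ.- (u ⨯ v) 1F)
sum₃-*-⨯ u v = identity (u 0F) (u 1F) (u 2F) (v 0F) (v 1F) (v 2F)
  where
  identity : ∀ a b c d e f →
    ((d ℤ.+ e) ℤ.+ f) ℤ.* a ≡ ((a ℤ.+ b) ℤ.+ c) ℤ.* d ℤ.+ ((a ℤ.* e ℤ.- b ℤ.* d) ℤ.- (c ℤ.* d ℤ.- a ℤ.* f))
  identity = solve-∀

⨯≡0⇒head≡ : ∀ {s} → s ≢ 0ℤ → ∀ u v → sum₃ u ≡ s → sum₃ v ≡ s → (∀ a → (u ⨯ v) a ≡ 0ℤ) → u 0F ≡ v 0F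
⨯≡0⇒head≡ {s} s≢0 u v Σu≡s Σv≡s u⨯v≡0 = ℤ.*-cancelˡ-≡ s (u 0F) (v 0F) {{ℤ.≢-nonZero s≢0}} (begin
  s ℤ.* u 0F                                            ≡⟨ cong (λ t → t ℤ.* u 0F) (sym Σv≡s) ⟩
  sum₃ v ℤ.* u 0F                                       ≡⟨ sum₃-*-⨯ u v ⟩
  sum₃ u ℤ.* v 0F ℤ.+ ((u ⨯ v) 2F ℤ.- (u ⨯ v) 1F)       ≡⟨ cong₂ (λ c₂ c₁ → sum₃ u ℤ.* v 0F ℤ.+ (c₂ ℤ.- c₁)) (u⨯v≡0 2F) (u⨯v≡0 1F) ⟩
  sum₃ u ℤ.* v 0F ℤ.+ 0ℤ                                ≡⟨ ℤ.+-identityʳ _ ⟩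
  sum₃ u ℤ.* v 0F                                       ≡⟨ cong (λ t → t ℤ.* v 0F) Σu≡s ⟩
  s ℤ.* v 0F                                            ∎)
  where open ≡-Reasoning

annihilator : ℤ → ℤ → ℤ³
annihilator s c 0F = s ℤ.- c
annihilator s c 1F = ℤ.- c
annihilator s c 2F = ℤ.- c

annihilator-∙ : ∀ s c x → annihilator s c ∙ x ≡ s ℤ.* x 0F ℤ.- c ℤ.* sum₃ x
annihilator-∙ s c x = identity s c (x 0F) (x 1F) (x 2F)
  where
  identity : ∀ s c a b d →
    ((s ℤ.- c) ℤ.* a ℤ.+ ℤ.- c ℤ.* b) ℤ.+ ℤ.- c ℤ.* d ≡ s ℤ.* a ℤ.- c ℤ.* ((a ℤ.+ b) ℤ.+ d)
  identity = solve-∀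

annihilator-orthogonal : ∀ {s} x → sum₃ x ≡ s → annihilator s (x 0F) ∙ x ≡ 0ℤ
annihilator-orthogonal {s} x Σx≡s = begin
  annihilator s (x 0F) ∙ x          ≡⟨ annihilator-∙ s (x 0F) x ⟩
  s ℤ.* x 0F ℤ.- x 0F ℤ.* sum₃ x    ≡⟨ cong (λ t → s ℤ.* x 0F ℤ.- x 0F ℤ.* t) Σx≡s ⟩
  s ℤ.* x 0F ℤ.- x 0F ℤ.* s         ≡⟨ cong (λ t → s ℤ.* x 0F ℤ.- t) (ℤ.*-comm (x 0F) s) ⟩
  s ℤ.* x 0F ℤ.- s ℤ.* x 0F         ≡⟨ ℤ.+-inverseʳ (s ℤ.* x 0F) ⟩
  0ℤ                                ∎
  where open ≡-Reasoning

annihilator-nonzero : ∀ {s} → s ≢ 0ℤ → ∀ c → ∃ λ a → annihilator s c a ≢ 0ℤ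
annihilator-nonzero {s} s≢0 c with c ℤ.≟ 0ℤ
... | yes refl = 0F , λ s-0≡0 → s≢0 (trans (sym (ℤ.+-identityʳ s)) s-0≡0)
... | no  c≢0  = 1F , λ -c≡0 → c≢0 (ℤ.neg-injective -c≡0)

common-orthogonal : ∀ {s} → s ≢ 0ℤ → ∀ u v → sum₃ u ≡ s → sum₃ v ≡ s →
                    ∃ λ z → (∃ λ a → z a ≢ 0ℤ) × z ∙ u ≡ 0ℤ × z ∙ v ≡ 0ℤ
common-orthogonal {s} s≢0 u v Σu≡s Σv≡s with all? (λ a → (u ⨯ v) a ℤ.≟ 0ℤ)
... | no  u⨯v≢0 = u ⨯ v , ¬∀⟶∃¬ 3 _ (λ a → (u ⨯ v) a ℤ.≟ 0ℤ) u⨯v≢0 , ⨯-orthogonalˡ u v , ⨯-orthogonalʳ u v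
... | yes u⨯v≡0 = annihilator s (u 0F) , annihilator-nonzero s≢0 (u 0F) , annihilator-orthogonal u Σu≡s ,
                  subst (λ c → annihilator s c ∙ v ≡ 0ℤ) (sym (⨯≡0⇒head≡ s≢0 u v Σu≡s Σv≡s u⨯v≡0)) (annihilator-orthogonal v Σv≡s)

parikh : Word → ℕ → ℕ → ℤ³
parikh w i m a = + countFrom w a i m

weight : Word → ℤ³ → ℕ → ℕ → ℤ
weight w z i m = z ∙ parikh w i m

module _ {w : Word} where

  parikh-sum : ∀ i m → sum₃ (parikh w i m) ≡ + m
  parikh-sum i m = cong +_ (countFrom-total w i m)

  weight-+ : ∀ z i m m′ → weight w z i (m + m′) ≡ weight w z i m ℤ.+ weight w z (i + m) m′
  weight-+ z i m m′ = begin
    z ∙ parikh w i (m + m′)                                 ≡⟨ ∙-congˡ z parikh-+ ⟩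
    z ∙ (λ a → parikh w i m a ℤ.+ parikh w (i + m) m′ a)     ≡⟨ ∙-distribˡ-+ z (parikh w i m) (parikh w (i + m) m′) ⟩
    weight w z i m ℤ.+ weight w z (i + m) m′                 ∎
    where
    open ≡-Reasoning
    parikh-+ : ∀ a → parikh w i (m + m′) a ≡ parikh w i m a ℤ.+ parikh w (i + m) m′ a
    parikh-+ a = cong +_ (countFrom-+ w a i m m′)

  weight-AbEq : ∀ z {n i j} → AbEq w n i j → weight w z i n ≡ weight w z j n
  weight-AbEq z i~j = ∙-congˡ z (λ a → cong +_ (i~j a))

  ∣weight∣≤ : ∀ z i m → ℤ.∣ weight w z i m ∣ ≤ ‖ z ‖₁ * m
  ∣weight∣≤ z i m = ∣∙∣≤ z {parikh w i m} (λ a → countFrom≤ w a i m)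

  module _ {z : ℤ³} {n : ℕ} (balanced : ∀ i → weight w z i n ≡ 0ℤ) where

    weight-*-zero : ∀ t i → weight w z i (t * n) ≡ 0ℤ
    weight-*-zero zero    i = ∙-zeroʳ z
    weight-*-zero (suc t) i rewrite weight-+ z i n (t * n) | balanced i | weight-*-zero t (i + n) = refl

    weight-% : .{{_ : NonZero n}} → ∀ i m → weight w z i m ≡ weight w z i (m % n)
    weight-% i m = begin
      weight w z i m                                                ≡⟨ cong (weight w z i) (m≡m%n+[m/n]*n m n) ⟩
      weight w z i (m % n + (m / n) * n)                            ≡⟨ weight-+ z i (m % n) _ ⟩
      weight w z i (m % n) ℤ.+ weight w z (i + m % n) ((m / n) * n) ≡⟨ cong (ℤ._+_ (weight w z i (m % n))) (weight-*-zero (m / n) _) ⟩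
      weight w z i (m % n) ℤ.+ 0ℤ                                   ≡⟨ ℤ.+-identityʳ _ ⟩
      weight w z i (m % n)                                          ∎
      where open ≡-Reasoning

    weight-bounded : .{{_ : NonZero n}} → ∀ i m → ℤ.∣ weight w z i m ∣ ≤ ‖ z ‖₁ * n
    weight-bounded i m = begin
      ℤ.∣ weight w z i m ∣        ≡⟨ cong ℤ.∣_∣ (weight-% i m) ⟩
      ℤ.∣ weight w z i (m % n) ∣  ≤⟨ ∣weight∣≤ z i (m % n) ⟩
      ‖ z ‖₁ * (m % n)             ≤⟨ ℕ.*-monoʳ-≤ ‖ z ‖₁ (ℕ.<⇒≤ (m%n<n m n)) ⟩
      ‖ z ‖₁ * n                   ∎
      where open ℕ.≤-Reasoning

module _ {w : Word} {n : ℕ} where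

  AbEq-trans : ∀ {i j k} → AbEq w n i j → AbEq w n j k → AbEq w n i k
  AbEq-trans i~j j~k a = trans (i~j a) (j~k a)

  AbComplexity≤-merge : ∀ {k} (ρ : AbComplexity≤ w n (suc k)) {s t} → s ≢ t →
                        AbEq w n (proj₁ ρ s) (proj₁ ρ t) → AbComplexity≤ w n k
  AbComplexity≤-merge (p , covers) {s} {t} s≢t ps~pt = p ∘ punchIn s , covers′
    where
    covers′ : ∀ i → ∃ λ j → AbEq w n i (p (punchIn s j))
    covers′ i with covers i
    ... | u , i~pu with s ≟ u
    ...   | yes refl = punchOut s≢t , subst (AbEq w n i ∘ p) (sym (punchIn-punchOut s≢t)) (AbEq-trans i~pu ps~pt)
    ...   | no  s≢u  = punchOut s≢u , subst (AbEq w n i ∘ p) (sym (punchIn-punchOut s≢u)) i~pu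

  AbComplexity≥-minimal : ∀ {k} → AbComplexity≤ w n (suc k) → ¬ AbComplexity≤ w n k → AbComplexity≥ w n (suc k)
  AbComplexity≥-minimal ρ ρ≰k = proj₁ ρ , λ s t s≢t ps~pt → ρ≰k (AbComplexity≤-merge ρ s≢t ps~pt)

toℚ³ : ℤ³ → Fin 3 → ℚ.ℚ
toℚ³ z a = z a ℚ./ 1

freqCombination : (Fin 3 → ℚ.ℚ) → Word → ℕ → ℚ.ℚ
freqCombination q w n = (q 0F ℚ.* freqSeq w 0F n ℚ.+ q 1F ℚ.* freqSeq w 1F n) ℚ.+ q 2F ℚ.* freqSeq w 2F n

toℚᵘ-/1*/suc : ∀ a b N → ℚ.toℚᵘ ((a ℚ./ 1) ℚ.* (b ℚ./ suc N)) ℚᵘ.≃ mkℚᵘ (a ℤ.* b) N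
toℚᵘ-/1*/suc a b N = begin
  ℚ.toℚᵘ ((a ℚ./ 1) ℚ.* (b ℚ./ suc N))              ≈⟨ ℚ.toℚᵘ-homo-* (a ℚ./ 1) (b ℚ./ suc N) ⟩
  ℚ.toℚᵘ (a ℚ./ 1) ℚᵘ.* ℚ.toℚᵘ (b ℚ./ suc N)         ≈⟨ ℚᵘ.*-cong (ℚ.toℚᵘ-fromℚᵘ (mkℚᵘ a 0)) (ℚ.toℚᵘ-fromℚᵘ (mkℚᵘ b N)) ⟩
  mkℚᵘ a 0 ℚᵘ.* mkℚᵘ b N                            ≈⟨ *≡* (cong (λ d → a ℤ.* b ℤ.* + suc d) (sym (ℕ.+-identityʳ N))) ⟩
  mkℚᵘ (a ℤ.* b) N                                  ∎
  where open ℚᵘ.≃-Reasoning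

mkℚᵘ-+ : ∀ a b N → mkℚᵘ a N ℚᵘ.+ mkℚᵘ b N ℚᵘ.≃ mkℚᵘ (a ℤ.+ b) N
mkℚᵘ-+ a b N = *≡* (trans (identity a b (+ suc N)) (cong (ℤ._*_ (a ℤ.+ b)) (sym (ℤ.pos-* (suc N) (suc N)))))
  where
  identity : ∀ a b d → (a ℤ.* d ℤ.+ b ℤ.* d) ℤ.* d ≡ (a ℤ.+ b) ℤ.* (d ℤ.* d)
  identity = solve-∀

freqCombination-weight : ∀ z w N → freqCombination (toℚ³ z) w N ≡ weight w z 0 (suc N) ℚ./ suc N
freqCombination-weight z w N = ℚ.toℚᵘ-injective (begin
  ℚ.toℚᵘ ((t 0F ℚ.+ t 1F) ℚ.+ t 2F)                      ≈⟨ ℚ.toℚᵘ-homo-+ (t 0F ℚ.+ t 1F) (t 2F) ⟩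
  ℚ.toℚᵘ (t 0F ℚ.+ t 1F) ℚᵘ.+ ℚ.toℚᵘ (t 2F)              ≈⟨ ℚᵘ.+-congˡ (ℚ.toℚᵘ (t 2F)) (ℚ.toℚᵘ-homo-+ (t 0F) (t 1F)) ⟩
  (ℚ.toℚᵘ (t 0F) ℚᵘ.+ ℚ.toℚᵘ (t 1F)) ℚᵘ.+ ℚ.toℚᵘ (t 2F)  ≈⟨ ℚᵘ.+-cong (ℚᵘ.+-cong (term 0F) (term 1F)) (term 2F) ⟩
  (m 0F ℚᵘ.+ m 1F) ℚᵘ.+ m 2F                            ≈⟨ ℚᵘ.+-congˡ (m 2F) (mkℚᵘ-+ (x 0F) (x 1F) N) ⟩
  mkℚᵘ (x 0F ℤ.+ x 1F) N ℚᵘ.+ m 2F                       ≈⟨ mkℚᵘ-+ (x 0F ℤ.+ x 1F) (x 2F) N ⟩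
  mkℚᵘ (weight w z 0 (suc N)) N                          ≈⟨ ℚ.toℚᵘ-fromℚᵘ (mkℚᵘ (weight w z 0 (suc N)) N) ⟨
  ℚ.toℚᵘ (weight w z 0 (suc N) ℚ./ suc N)                ∎)
  where
  open ℚᵘ.≃-Reasoning
  t : Fin 3 → ℚ.ℚ
  t a = toℚ³ z a ℚ.* freqSeq w a N
  x : Fin 3 → ℤ
  x a = z a ℤ.* parikh w 0 (suc N) a
  m : Fin 3 → ℚᵘ
  m a = mkℚᵘ (x a) N
  term : ∀ a → ℚ.toℚᵘ (t a) ℚᵘ.≃ m a
  term a = toℚᵘ-/1*/suc (z a) (parikh w 0 (suc N) a) N

/suc-tendsToZero : ∀ (L : ℕ → ℤ) B → (∀ N → ℤ.∣ L N ∣ ≤ B) → TendsToZero (λ N → L N ℚ./ suc N)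
/suc-tendsToZero L B bounded k = B * suc k , small
  where
  small : ∀ N → B * suc k ≤ N → ℚ.∣ L N ℚ./ suc N ∣ ℚ.< eps k
  small N B[1+k]≤N = ℚ.toℚᵘ-cancel-< (begin-strict
    ℚ.toℚᵘ ℚ.∣ L N ℚ./ suc N ∣       ≃⟨ ℚ.toℚᵘ-homo-∣-∣ (L N ℚ./ suc N) ⟩
    ℚᵘ.∣ ℚ.toℚᵘ (L N ℚ./ suc N) ∣    ≃⟨ ℚᵘ.∣-∣-cong (ℚ.toℚᵘ-fromℚᵘ (mkℚᵘ (L N) N)) ⟩
    mkℚᵘ (+ ℤ.∣ L N ∣) N             <⟨ *<* numerators ⟩
    mkℚᵘ (+ 1) k                      ≃⟨ ℚ.toℚᵘ-fromℚᵘ (mkℚᵘ (+ 1) k) ⟨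
    ℚ.toℚᵘ (eps k)                    ∎)
    where
    open ℚᵘ.≤-Reasoning
    numerators : + ℤ.∣ L N ∣ ℤ.* + suc k ℤ.< + 1 ℤ.* + suc N
    numerators = subst₂ ℤ._<_ (ℤ.pos-* ℤ.∣ L N ∣ (suc k)) (sym (ℤ.*-identityˡ (+ suc N)))
      (ℤ.+<+ (ℕ.s≤s (ℕ.≤-trans (ℕ.*-monoˡ-≤ (suc k) (bounded N)) B[1+k]≤N)))

TendsToZero-cong : ∀ {x y} → (∀ n → x n ≡ y n) → TendsToZero x → TendsToZero y
TendsToZero-cong x≗y x→0 k with x→0 k
... | N , small = N , λ n N≤n → subst (λ q → ℚ.∣ q ∣ ℚ.< eps k) (x≗y n) (small n N≤n)

/1-injective : ∀ {i j} → i ℚ./ 1 ≡ j ℚ./ 1 → i ≡ j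
/1-injective {i} {j} i≡j with ℚ.fromℚᵘ-injective {mkℚᵘ i 0} {mkℚᵘ j 0} i≡j
... | *≡* i*1≡j*1 = trans (sym (ℤ.*-identityʳ i)) (trans i*1≡j*1 (ℤ.*-identityʳ j))

balanced⇒dependent : ∀ {w n} .{{_ : NonZero n}} z → (∃ λ a → z a ≢ 0ℤ) →
                     (∀ i → weight w z i n ≡ 0ℤ) → ¬ RationallyIndependentFreqs w
balanced⇒dependent {w} {n} z (a , za≢0) balanced independent =
  independent (toℚ³ z) (a , za≢0 ∘ /1-injective)
    (TendsToZero-cong (sym ∘ freqCombination-weight z w)
      (/suc-tendsToZero (λ N → weight w z 0 (suc N)) (‖ z ‖₁ * n) (λ N → weight-bounded {w} {z} {n} balanced 0 (suc N))))

AbComplexity≤2⇒dependent : ∀ {w n} .{{_ : NonZero n}} → AbComplexity≤ w n 2 → ¬ RationallyIndependentFreqs w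
AbComplexity≤2⇒dependent {w} {n} (p , covers)
  with common-orthogonal (ℕ.≢-nonZero⁻¹ n ∘ ℤ.+-injective) (parikh w (p 0F) n) (parikh w (p 1F) n) (parikh-sum _ _) (parikh-sum _ _)
... | z , z≢0 , z⊥u , z⊥v = balanced⇒dependent z z≢0 balanced
  where
  balanced : ∀ i → weight w z i n ≡ 0ℤ
  balanced i with covers i
  ... | 0F , i~p₀ = trans (weight-AbEq {w} z {n} i~p₀) z⊥u
  ... | 1F , i~p₁ = trans (weight-AbEq {w} z {n} i~p₁) z⊥v

corollary11 : (w : Word) → HasFrequencies w → RationallyIndependentFreqs w →
              ((n : ℕ) → 1 ≤ n → AbComplexity≤ w n 3) →
              (n : ℕ) → 1 ≤ n → AbComplexity≡ w n 3
corollary11 w _ independent ρ≤3 n 1≤n =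
  ρ≤3 n 1≤n , AbComplexity≥-minimal {w} {n} (ρ≤3 n 1≤n) (λ ρ≤2 → AbComplexity≤2⇒dependent {{ℕ.>-nonZero 1≤n}} ρ≤2 independent)
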